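{- Let $G(A\sqcup B,E)$ be a bipartite graph with $|A|\ge 2$ and $B\neq\varnothing$, and let $a\in A$ satisfy $\deg_G(a)\le \mathrm{avgdeg}(G,A)/2$. Let $A'=A\setminus\{a\}$ and $G'=G[A'\sqcup B]$. Then $\psi(G')\ge\psi(G)$ and $\mathrm{avgdeg}(G',A')\ge\mathrm{avgdeg}(G,A)$.
   Context: For a graph $G$ and a nonempty set of nodes $S$, $\mathrm{avgdeg}(G,S)=\frac{1}{|S|}\sum_{v\in S}\deg_G(v)$. For a bipartite graph $G(A\sqcup B,E)$ with nonempty parts, $\psi(G)=\mathrm{avgdeg}(G,A)\cdot\mathrm{avgdeg}(G,B)$. $G[S]$ denotes the subgraph induced by $S$. -}

module Defs where

open import Data.Bool using (Bool; true; false; if_then_else_)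
open import Data.Nat using (ℕ; suc; NonZero)
open import Data.Fin using (Fin; punchIn)
open import Data.List using (List; map; allFin)
open import Data.Nat.ListAction using (sum)
open import Data.Integer using (+_)
open import Data.Rational using (ℚ; _/_; _*_)

-- A (simple) bipartite graph G(A ⊔ B, E) with A = Fin m, B = Fin n;
-- E ⊆ A × B is given by its (decidable) adjacency relation.
record BipGraph (m n : ℕ) : Set where
  field
    adj : Fin m → Fin n → Bool
open BipGraph public

count : (k : ℕ) → (Fin k → Bool) → ℕ
count k p = sum (map (λ i → if p i then 1 else 0) (allFin k))

degA : ∀ {m n} → BipGraph m n → Fin m → ℕ
degA {m} {n} G a = count n (λ b → adj G a b)

degB : ∀ {m n} → BipGraph m n → Fin n → ℕ
degB {m} {n} G b = count m (λ a → adj G a b)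

avgdegA : ∀ {m n} → BipGraph m n → .{{NonZero m}} → ℚ
avgdegA {m} {n} G = (+ sum (map (degA G) (allFin m))) / m

avgdegB : ∀ {m n} → BipGraph m n → .{{NonZero n}} → ℚ
avgdegB {m} {n} G = (+ sum (map (degB G) (allFin n))) / n

ψ : ∀ {m n} → BipGraph m n → .{{NonZero m}} → .{{NonZero n}} → ℚ
ψ G = avgdegA G * avgdegB G

-- G[(A ∖ {a}) ⊔ B]: the induced subgraph after deleting a ∈ A.
-- The nodes of A ∖ {a} are enumerated by punchIn a : Fin m → Fin (suc m),
-- a bijection onto {x | x ≠ a}.
deleteA : ∀ {m n} → BipGraph (suc m) n → Fin (suc m) → BipGraph m n
deleteA G a = record { adj = λ i b → adj G (punchIn a i) b }

-- Let d be the degree of a, S the number of edges of G', |A| = m + 1 and |A'| = m.  Both degree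
-- sums of a bipartite graph count its edges, so avgdeg(G, A) = (d + S)/(m + 1) and
-- ψ(G) = (d + S)²/((m + 1)|B|), and likewise for G' with S in place of d + S.  Cross-multiplied,
-- the hypothesis reads d (2m + 1) ≤ S, and the conclusions become (d + S) m ≤ S (m + 1), which
-- needs only d m ≤ S, and (d + S)² m ≤ S² (m + 1), i.e. d² m + 2 d S m ≤ S², which follows
-- from d² m ≤ d S and d S (2m + 1) ≤ S².
module Submission where

open import Defs
open import Algebra.Properties.CommutativeMonoid.Sum as ∑ using ()
open import Data.Bool using (if_then_else_)
open import Data.Fin using (Fin; zero; suc)
open import Data.Integer as ℤ using (+_)
open import Data.Integer.Properties using (pos-*; drop‿+≤+)
open import Data.List using (map; allFin; tabulate)
open import Data.List.Properties using (map-tabulate)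
open import Data.Nat as ℕ using (ℕ; suc; NonZero)
open import Data.Nat.ListAction using (sum)
open import Data.Nat.Properties as ℕ using (+-0-commutativeMonoid)
open import Data.Nat.Tactic.RingSolver using (solve-∀)
open import Data.Product using (_×_; _,_)
open import Relation.Binary.PropositionalEquality

open ∑ +-0-commutativeMonoid using (sum-syntax; sum-cong-≗; sum-remove; ∑-comm)

module _ where
  open import Data.Nat using (_+_; _*_; _≤_)
  open ℕ.≤-Reasoning

  low-degree-bound : ∀ d S m → d * (suc m * 2) ≤ d + S → d * (1 + 2 * m) ≤ S
  low-degree-bound d S m h = ℕ.+-cancelˡ-≤ d _ _ (subst (_≤ d + S) (expand d m) h)
    where
    expand : ∀ d m → d * (suc m * 2) ≡ d + d * (1 + 2 * m)
    expand = solve-∀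

  low-degree-weaken : ∀ d S m → d * (1 + 2 * m) ≤ S → d * m ≤ S
  low-degree-weaken d S m = ℕ.≤-trans (ℕ.*-monoʳ-≤ d (ℕ.m≤n⇒m≤1+n (ℕ.m≤m+n m _)))

  avgdegA-cross-≤ : ∀ d S m → d * m ≤ S → (d + S) * m ≤ S * suc m
  avgdegA-cross-≤ d S m h = begin
    (d + S) * m   ≡⟨ ℕ.*-distribʳ-+ m d S ⟩
    d * m + S * m ≤⟨ ℕ.+-monoˡ-≤ (S * m) h ⟩
    S + S * m     ≡⟨ ℕ.*-suc S m ⟨
    S * suc m     ∎

  ψ-cross-≤ : ∀ d S m n → d * (1 + 2 * m) ≤ S →
    (d + S) * (d + S) * (m * n) ≤ S * S * (suc m * n)
  ψ-cross-≤ d S m n h = subst₂ _≤_ (ℕ.*-assoc ((d + S) * (d + S)) m n) (ℕ.*-assoc (S * S) (suc m) n)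
    (ℕ.*-monoˡ-≤ n unscaled)
    where
    square : ∀ d S m → (d + S) * (d + S) * m ≡ d * (d * m) + S * (d * (2 * m)) + S * S * m
    square = solve-∀
    collect : ∀ d S m → d * S + S * (d * (2 * m)) + S * S * m ≡ S * (d * (1 + 2 * m)) + S * S * m
    collect = solve-∀
    unscaled : (d + S) * (d + S) * m ≤ S * S * suc m
    unscaled = begin
      (d + S) * (d + S) * m                         ≡⟨ square d S m ⟩
      d * (d * m) + S * (d * (2 * m)) + S * S * m
        ≤⟨ ℕ.+-monoˡ-≤ _ (ℕ.+-monoˡ-≤ _ (ℕ.*-monoʳ-≤ d (low-degree-weaken d S m h))) ⟩
      d * S + S * (d * (2 * m)) + S * S * m         ≡⟨ collect d S m ⟩
      S * (d * (1 + 2 * m)) + S * S * m             ≤⟨ ℕ.+-monoˡ-≤ _ (ℕ.*-monoʳ-≤ S h) ⟩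
      S * S + S * S * m                             ≡⟨ ℕ.*-suc (S * S) m ⟨
      S * S * suc m                                 ∎

open import Data.Rational using (ℚ; _/_; _*_; _≤_; ½; toℚᵘ)
open import Data.Rational.Properties
  using (toℚᵘ-fromℚᵘ; toℚᵘ-homo-*; toℚᵘ-injective; toℚᵘ-mono-≤; toℚᵘ-cancel-≤)
open import Data.Rational.Unnormalised as ℚᵘ using (mkℚᵘ) renaming (_≃_ to _≃ᵘ_)
import Data.Rational.Unnormalised.Properties as ℚᵘ

toℚᵘ-/ : ∀ a b .{{_ : NonZero b}} → toℚᵘ (+ a / b) ≃ᵘ + a ℚᵘ./ b
toℚᵘ-/ a (suc b) = toℚᵘ-fromℚᵘ (mkℚᵘ (+ a) b)

/-*-/ : ∀ a b c d .{{_ : NonZero b}} .{{_ : NonZero d}} →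
  (+ a / b) * (+ c / d) ≡ (+ (a ℕ.* c) / (b ℕ.* d)) {{ℕ.m*n≢0 b d}}
/-*-/ a b@(suc _) c d@(suc _) = toℚᵘ-injective (begin
  toℚᵘ ((+ a / b) * (+ c / d))        ≈⟨ toℚᵘ-homo-* (+ a / b) (+ c / d) ⟩
  toℚᵘ (+ a / b) ℚᵘ.* toℚᵘ (+ c / d)  ≈⟨ ℚᵘ.*-cong (toℚᵘ-/ a b) (toℚᵘ-/ c d) ⟩
  (+ a ℤ.* + c) ℚᵘ./ (b ℕ.* d)        ≡⟨ cong (ℚᵘ._/ (b ℕ.* d)) (pos-* a c) ⟨
  + (a ℕ.* c) ℚᵘ./ (b ℕ.* d)          ≈⟨ toℚᵘ-/ (a ℕ.* c) (b ℕ.* d) ⟨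
  toℚᵘ (+ (a ℕ.* c) / (b ℕ.* d))      ∎)
  where open ℚᵘ.≃-Reasoning

cross-≤⇒/-≤ : ∀ a b c d .{{_ : NonZero b}} .{{_ : NonZero d}} →
  a ℕ.* d ℕ.≤ c ℕ.* b → + a / b ≤ + c / d
cross-≤⇒/-≤ a b@(suc _) c d@(suc _) h = toℚᵘ-cancel-≤
  (ℚᵘ.≤-respˡ-≃ (ℚᵘ.≃-sym (toℚᵘ-/ a b)) (ℚᵘ.≤-respʳ-≃ (ℚᵘ.≃-sym (toℚᵘ-/ c d))
    (ℚᵘ.*≤* (subst₂ ℤ._≤_ (pos-* a d) (pos-* c b) (ℤ.+≤+ h)))))

/-≤⇒cross-≤ : ∀ a b c d .{{_ : NonZero b}} .{{_ : NonZero d}} →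
  + a / b ≤ + c / d → a ℕ.* d ℕ.≤ c ℕ.* b
/-≤⇒cross-≤ a b@(suc _) c d@(suc _) h
  with ℚᵘ.≤-respˡ-≃ (toℚᵘ-/ a b) (ℚᵘ.≤-respʳ-≃ (toℚᵘ-/ c d) (toℚᵘ-mono-≤ h))
... | ℚᵘ.*≤* h′ = drop‿+≤+ (subst₂ ℤ._≤_ (sym (pos-* a d)) (sym (pos-* c b)) h′)

sum-tabulate : ∀ n (f : Fin n → ℕ) → sum (tabulate f) ≡ ∑[ i < n ] f i
sum-tabulate ℕ.zero  f = refl
sum-tabulate (suc n) f = cong (f zero ℕ.+_) (sum-tabulate n (λ i → f (suc i)))

sum-allFin : ∀ n (f : Fin n → ℕ) → sum (map f (allFin n)) ≡ ∑[ i < n ] f i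
sum-allFin n f = trans (cong sum (map-tabulate (λ i → i) f)) (sum-tabulate n f)

edges : ∀ {m n} → BipGraph m n → ℕ
edges {m} G = ∑[ a < m ] degA G a

sum-degA : ∀ {m n} (G : BipGraph m n) → sum (map (degA G) (allFin m)) ≡ edges G
sum-degA {m} G = sum-allFin m (degA G)

sum-degB : ∀ {m n} (G : BipGraph m n) → sum (map (degB G) (allFin n)) ≡ edges G
sum-degB {m} {n} G = begin
  sum (map (degB G) (allFin n))  ≡⟨ sum-allFin n (degB G) ⟩
  ∑[ b < n ] degB G b            ≡⟨ sum-cong-≗ (λ b → sum-allFin m (λ a → edge a b)) ⟩
  ∑[ b < n ] ∑[ a < m ] edge a b ≡⟨ ∑-comm (λ b a → edge a b) ⟩
  ∑[ a < m ] ∑[ b < n ] edge a b ≡⟨ sum-cong-≗ (λ a → sum-allFin n (edge a)) ⟨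
  edges G                        ∎
  where
  open ≡-Reasoning
  edge : Fin m → Fin n → ℕ
  edge a b = if adj G a b then 1 else 0

edges-deleteA : ∀ {m n} (G : BipGraph (suc m) n) a → edges G ≡ degA G a ℕ.+ edges (deleteA G a)
edges-deleteA G a = sum-remove (degA G)

avgdegA-edges : ∀ {m n} (G : BipGraph (suc m) n) → avgdegA G ≡ + edges G / suc m
avgdegA-edges {m} G = cong (λ e → + e / suc m) (sum-degA G)

avgdegB-edges : ∀ {m n} (G : BipGraph m (suc n)) → avgdegB G ≡ + edges G / suc n
avgdegB-edges {n = n} G = cong (λ e → + e / suc n) (sum-degB G)

ψ-edges : ∀ {m n} (G : BipGraph (suc m) (suc n)) →
  ψ G ≡ + (edges G ℕ.* edges G) / (suc m ℕ.* suc n)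
ψ-edges {m} {n} G =
  trans (cong₂ _*_ (avgdegA-edges G) (avgdegB-edges G)) (/-*-/ (edges G) (suc m) (edges G) (suc n))

avgdegA-split : ∀ {m n} (G : BipGraph (suc m) n) a →
  avgdegA G ≡ + (degA G a ℕ.+ edges (deleteA G a)) / suc m
avgdegA-split {m} G a = trans (avgdegA-edges G) (cong (λ e → + e / suc m) (edges-deleteA G a))

ψ-split : ∀ {m n} (G : BipGraph (suc m) (suc n)) a → let E = degA G a ℕ.+ edges (deleteA G a) in
  ψ G ≡ + (E ℕ.* E) / (suc m ℕ.* suc n)
ψ-split {m} {n} G a =
  trans (ψ-edges G) (cong (λ e → + (e ℕ.* e) / (suc m ℕ.* suc n)) (edges-deleteA G a))

low-degree-deleteA : ∀ {m n} (G : BipGraph (suc m) n) a → (+ degA G a) / 1 ≤ avgdegA G * ½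
  → degA G a ℕ.* (1 ℕ.+ 2 ℕ.* m) ℕ.≤ edges (deleteA G a)
low-degree-deleteA {m} G a h = low-degree-bound (degA G a) (edges (deleteA G a)) m
  (subst (degA G a ℕ.* (suc m ℕ.* 2) ℕ.≤_) (trans (unit-factors (edges G)) (edges-deleteA G a))
    (/-≤⇒cross-≤ (degA G a) 1 (edges G ℕ.* 1) (suc m ℕ.* 2)
      (subst ((+ degA G a) / 1 ≤_) avgdeg/2 h)))
  where
  avgdeg/2 : avgdegA G * ½ ≡ + (edges G ℕ.* 1) / (suc m ℕ.* 2)
  avgdeg/2 = trans (cong (_* ½) (avgdegA-edges G)) (/-*-/ (edges G) (suc m) 1 2)
  unit-factors : ∀ e → e ℕ.* 1 ℕ.* 1 ≡ e
  unit-factors = solve-∀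

lemma5 : (k n : ℕ) (G : BipGraph (suc (suc k)) (suc n)) (a : Fin (suc (suc k)))
    → (+ degA G a) / 1 ≤ avgdegA G * ½
    → (ψ G ≤ ψ (deleteA G a)) × (avgdegA G ≤ avgdegA (deleteA G a))
lemma5 k n G a h =
    subst₂ _≤_ (sym (ψ-split G a)) (sym (ψ-edges G′))
      (cross-≤⇒/-≤ ((d ℕ.+ S) ℕ.* (d ℕ.+ S)) (suc m ℕ.* suc n) (S ℕ.* S) (m ℕ.* suc n)
        (ψ-cross-≤ d S m (suc n) bound))
  , subst₂ _≤_ (sym (avgdegA-split G a)) (sym (avgdegA-edges G′))
      (cross-≤⇒/-≤ (d ℕ.+ S) (suc m) S m
        (avgdegA-cross-≤ d S m (low-degree-weaken d S m bound)))
  where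
  m = suc k
  G′ = deleteA G a
  d = degA G a
  S = edges G′
  bound : d ℕ.* (1 ℕ.+ 2 ℕ.* m) ℕ.≤ S
  bound = low-degree-deleteA G a h
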